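{- Let $(A,\mu)$ be a state-morphism pseudo BCK-algebra. Then: (1) $\mu$ is injective iff ${\rm Ker}(\mu)=\{1\}$; (2) if $D$ is a deductive system of $A$ then $\mu^{ -1}(D)$ is a deductive system of $A$ and ${\rm Ker}(\mu)\subseteq\mu^{ -1}(D)$; (3) if $D$ is a normal deductive system of $A$ then $\mu^{ -1}(D)$ is a normal deductive system of $A$; (4) if $D$ is a commutative deductive system of $A$ then $\mu^{ -1}(D)$ is a commutative deductive system of $A$; (5) if $\mu$ is surjective and $D$ is a $\mu$-state deductive system of $A$, then $\mu(D)$ and $\mu(\mu(D))$ are $\mu$-state deductive systems of $A$.
   Context: A pseudo BCK-algebra is an algebra $(A,\rightarrow,\rightsquigarrow,1)$ of type $(2,2,0)$ such that for all $x,y,z\in A$: $(x\rightarrow y)\rightsquigarrow[(y\rightarrow z)\rightsquigarrow(x\rightarrow z)]=1$; $(x\rightsquigarrow y)\rightarrow[(y\rightsquigarrow z)\rightarrow(x\rightsquigarrow z)]=1$; $1\rightarrow x=x$; $1\rightsquigarrow x=x$; $x\rightarrow 1=1$; and if $x\rightarrow y=1$ and $y\rightarrow x=1$ then $x=y$. The order is $x\le y$ iff $x\rightarrow y=1$ (iff $x\rightsquigarrow y=1$). A deductive system is a subset $D$ with $1\in D$ such that $x, x\rightarrow y\in D$ imply $y\in D$; it is normal if $x\rightarrow y\in D$ iff $x\rightsquigarrow y\in D$; it is commutative if $y\rightarrow x\in D$ implies $((x\rightarrow y)\rightsquigarrow y)\rightarrow x\in D$ and $y\rightsquigarrow x\in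 D$ implies $((x\rightsquigarrow y)\rightarrow y)\rightsquigarrow x\in D$. A state-morphism operator on $A$ is a homomorphism $\mu:A\to A$ (i.e. $\mu(x\rightarrow y)=\mu(x)\rightarrow\mu(y)$, $\mu(x\rightsquigarrow y)=\mu(x)\rightsquigarrow\mu(y)$, $\mu(1)=1$) with $\mu\circ\mu=\mu$; then $(A,\mu)$ is a state-morphism pseudo BCK-algebra. ${\rm Ker}(\mu)=\{x\in A\mid\mu(x)=1\}$. A deductive system $D$ is a $\mu$-state deductive system if $\mu(D)\subseteq D$. -}

module Defs where

open import Level using (Level; _⊔_; suc)
open import Data.Product using (Σ; _×_; _,_; ∃)
open import Relation.Binary.PropositionalEquality using (_≡_)
open import Function.Bundles using (_⇔_)

record PseudoBCK (a : Level) : Set (suc a) where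
  infixr 5 _⇒_ _⇝_
  field
    Carrier : Set a
    _⇒_ : Carrier → Carrier → Carrier
    _⇝_ : Carrier → Carrier → Carrier
    𝟏 : Carrier
    ax1 : ∀ x y z → (x ⇒ y) ⇝ ((y ⇒ z) ⇝ (x ⇒ z)) ≡ 𝟏
    ax2 : ∀ x y z → (x ⇝ y) ⇒ ((y ⇝ z) ⇒ (x ⇝ z)) ≡ 𝟏
    ax3 : ∀ x → 𝟏 ⇒ x ≡ x
    ax4 : ∀ x → 𝟏 ⇝ x ≡ x
    ax5 : ∀ x → x ⇒ 𝟏 ≡ 𝟏
    ax6 : ∀ x y → x ⇒ y ≡ 𝟏 → y ⇒ x ≡ 𝟏 → x ≡ y

module _ {a : Level} (A : PseudoBCK a) where
  open PseudoBCK A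

  Subset : (ℓ : Level) → Set (a ⊔ suc ℓ)
  Subset ℓ = Carrier → Set ℓ

  _⊆_ : ∀ {ℓ ℓ'} → Subset ℓ → Subset ℓ' → Set (a ⊔ ℓ ⊔ ℓ')
  P ⊆ Q = ∀ {x} → P x → Q x

  record IsDS {ℓ} (D : Subset ℓ) : Set (a ⊔ ℓ) where
    field
      one∈ : D 𝟏
      mp   : ∀ {x y} → D x → D (x ⇒ y) → D y

  IsNormalDS : ∀ {ℓ} → Subset ℓ → Set (a ⊔ ℓ)
  IsNormalDS D = IsDS D × (∀ x y → D (x ⇒ y) ⇔ D (x ⇝ y))

  IsCommutativeDS : ∀ {ℓ} → Subset ℓ → Set (a ⊔ ℓ)
  IsCommutativeDS D = IsDS D ×
    ((∀ x y → D (y ⇒ x) → D (((x ⇒ y) ⇝ y) ⇒ x)) ×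
     (∀ x y → D (y ⇝ x) → D (((x ⇝ y) ⇒ y) ⇝ x)))

  record IsStateMorphism (μ : Carrier → Carrier) : Set a where
    field
      hom⇒ : ∀ x y → μ (x ⇒ y) ≡ μ x ⇒ μ y
      hom⇝ : ∀ x y → μ (x ⇝ y) ≡ μ x ⇝ μ y
      hom𝟏 : μ 𝟏 ≡ 𝟏
      idem : ∀ x → μ (μ x) ≡ μ x

  Ker : (Carrier → Carrier) → Subset a
  Ker μ x = μ x ≡ 𝟏

  preimage : ∀ {ℓ} → (Carrier → Carrier) → Subset ℓ → Subset ℓ
  preimage μ D x = D (μ x)

  image : ∀ {ℓ} → (Carrier → Carrier) → Subset ℓ → Subset (a ⊔ ℓ)
  image μ D y = ∃ λ x → D x × μ x ≡ y

  IsStateDS : ∀ {ℓ} → (Carrier → Carrier) → Subset ℓ → Set (a ⊔ ℓ)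
  IsStateDS μ D = IsDS D × (image μ D ⊆ D)

-- Parts (1)–(4) only use that μ is a homomorphism: a homomorphism has trivial
-- kernel iff it is injective because x = y follows from x ⇒ y = y ⇒ x = 1, and
-- every defining condition of a (normal, commutative) deductive system is a
-- closure condition in terms of ⇒, ⇝ and 1, which μ commutes with.
-- For (5), a surjective idempotent map is the identity, so μ(D) = D.
module Submission where

open import Defs
open import Level using (Level)
open import Data.Product using (_×_; _,_)
open import Relation.Binary.PropositionalEquality
  using (_≡_; refl; sym; trans; cong; cong₂; subst; module ≡-Reasoning)
open import Relation.Unary using (_≐_)
open import Relation.Unary.Properties using (≐-sym)
open import Function.Bundles using (_⇔_; mk⇔; module Equivalence)
open import Function.Definitions using (Injective; Surjective)

open Equivalence using (to; from)

module _ {a : Level} (A : PseudoBCK a) where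
  open PseudoBCK A

  ⇒-refl : ∀ x → x ⇒ x ≡ 𝟏
  ⇒-refl x = begin
    x ⇒ x                         ≡⟨ ax3 (x ⇒ x) ⟨
    𝟏 ⇒ (x ⇒ x)                   ≡⟨ cong₂ (λ u v → u ⇒ (v ⇒ v)) (ax4 𝟏) (ax4 x) ⟨
    (𝟏 ⇝ 𝟏) ⇒ ((𝟏 ⇝ x) ⇒ (𝟏 ⇝ x)) ≡⟨ ax2 𝟏 𝟏 x ⟩
    𝟏                             ∎
    where open ≡-Reasoning

  IsDS-resp-≐ : ∀ {ℓ ℓ′} {D : Subset A ℓ} {E : Subset A ℓ′} →
                D ≐ E → IsDS A D → IsDS A E
  IsDS-resp-≐ (D⊆E , E⊆D) ds = record
    { one∈ = D⊆E (IsDS.one∈ ds)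
    ; mp   = λ ex exy → D⊆E (IsDS.mp ds (E⊆D ex) (E⊆D exy))
    }

  module _ (μ : Carrier → Carrier) where

    IsStateDS-resp-≐ : ∀ {ℓ ℓ′} {D : Subset A ℓ} {E : Subset A ℓ′} →
                       D ≐ E → IsStateDS A μ D → IsStateDS A μ E
    IsStateDS-resp-≐ (D⊆E , E⊆D) (ds , μD⊆D) =
      IsDS-resp-≐ (D⊆E , E⊆D) ds ,
      λ { (x , ex , μx≡y) → D⊆E (μD⊆D (x , E⊆D ex , μx≡y)) }

    image-of-identity : ∀ {ℓ} (D : Subset A ℓ) → (∀ x → μ x ≡ x) → image A μ D ≐ D
    image-of-identity D μ≗id =
      (λ { (x , dx , μx≡y) → subst D (trans (sym (μ≗id x)) μx≡y) dx }) ,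
      (λ {y} dy → y , dy , μ≗id y)

    surjective-idempotent⇒identity : Surjective _≡_ _≡_ μ → (∀ x → μ (μ x) ≡ μ x) →
                                     ∀ y → μ y ≡ y
    surjective-idempotent⇒identity surj idem y with surj y
    ... | x , μ≡y = begin
      μ y     ≡⟨ cong μ (μ≡y refl) ⟨
      μ (μ x) ≡⟨ idem x ⟩
      μ x     ≡⟨ μ≡y refl ⟩
      y       ∎
      where open ≡-Reasoning

  module _ {μ : Carrier → Carrier} (SM : IsStateMorphism A μ) where
    open IsStateMorphism SM

    injective⇔trivial-Ker : Injective _≡_ _≡_ μ ⇔ (∀ x → Ker A μ x ⇔ (x ≡ 𝟏))
    injective⇔trivial-Ker = mk⇔
      (λ inj x → mk⇔ (λ μx≡𝟏 → inj (trans μx≡𝟏 (sym hom𝟏))) λ { refl → hom𝟏 })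
      (λ trivial {x} {y} μx≡μy →
         ax6 x y (to (trivial (x ⇒ y)) (μ-⇒≡𝟏 μx≡μy))
                 (to (trivial (y ⇒ x)) (μ-⇒≡𝟏 (sym μx≡μy))))
      where
      μ-⇒≡𝟏 : ∀ {x y} → μ x ≡ μ y → μ (x ⇒ y) ≡ 𝟏
      μ-⇒≡𝟏 {x} {y} μx≡μy = begin
        μ (x ⇒ y)   ≡⟨ hom⇒ x y ⟩
        μ x ⇒ μ y   ≡⟨ cong (_⇒ μ y) μx≡μy ⟩
        μ y ⇒ μ y   ≡⟨ ⇒-refl (μ y) ⟩
        𝟏           ∎
        where open ≡-Reasoning

    module _ {ℓ : Level} {D : Subset A ℓ} where

      preimage-⇒ : ∀ {x y} → preimage A μ D (x ⇒ y) ⇔ D (μ x ⇒ μ y)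
      preimage-⇒ {x} {y} = mk⇔ (subst D (hom⇒ x y)) (subst D (sym (hom⇒ x y)))

      preimage-⇝ : ∀ {x y} → preimage A μ D (x ⇝ y) ⇔ D (μ x ⇝ μ y)
      preimage-⇝ {x} {y} = mk⇔ (subst D (hom⇝ x y)) (subst D (sym (hom⇝ x y)))

      preimage-IsDS : IsDS A D → IsDS A (preimage A μ D)
      preimage-IsDS ds = record
        { one∈ = subst D (sym hom𝟏) (IsDS.one∈ ds)
        ; mp   = λ dx dxy → IsDS.mp ds dx (to preimage-⇒ dxy)
        }

      Ker⊆preimage : IsDS A D → _⊆_ A (Ker A μ) (preimage A μ D)
      Ker⊆preimage ds μx≡𝟏 = subst D (sym μx≡𝟏) (IsDS.one∈ ds)

      preimage-IsNormalDS : IsNormalDS A D → IsNormalDS A (preimage A μ D)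
      preimage-IsNormalDS (ds , normal) = preimage-IsDS ds , λ x y → mk⇔
        (λ dxy → from preimage-⇝ (to (normal (μ x) (μ y)) (to preimage-⇒ dxy)))
        (λ dxy → from preimage-⇒ (from (normal (μ x) (μ y)) (to preimage-⇝ dxy)))

      preimage-IsCommutativeDS : IsCommutativeDS A D → IsCommutativeDS A (preimage A μ D)
      preimage-IsCommutativeDS (ds , comm⇒ , comm⇝) = preimage-IsDS ds ,
        (λ x y dyx → from preimage-⇒
           (subst (λ z → D (z ⇒ μ x)) (sym (μ-⇝-⇒ x y)) (comm⇒ (μ x) (μ y) (to preimage-⇒ dyx)))) ,
        (λ x y dyx → from preimage-⇝
           (subst (λ z → D (z ⇝ μ x)) (sym (μ-⇒-⇝ x y)) (comm⇝ (μ x) (μ y) (to preimage-⇝ dyx))))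
        where
        μ-⇝-⇒ : ∀ x y → μ ((x ⇒ y) ⇝ y) ≡ (μ x ⇒ μ y) ⇝ μ y
        μ-⇝-⇒ x y = trans (hom⇝ (x ⇒ y) y) (cong (_⇝ μ y) (hom⇒ x y))
        μ-⇒-⇝ : ∀ x y → μ ((x ⇝ y) ⇒ y) ≡ (μ x ⇝ μ y) ⇒ μ y
        μ-⇒-⇝ x y = trans (hom⇒ (x ⇝ y) y) (cong (_⇒ μ y) (hom⇝ x y))

    surjective-image-IsStateDS : Surjective _≡_ _≡_ μ → ∀ {ℓ} (D : Subset A ℓ) →
      IsStateDS A μ D → IsStateDS A μ (image A μ D) × IsStateDS A μ (image A μ (image A μ D))
    surjective-image-IsStateDS surj D sds =
      IsStateDS-resp-≐ μ (image≐ D) sds ,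
      IsStateDS-resp-≐ μ (image≐ (image A μ D)) (IsStateDS-resp-≐ μ (image≐ D) sds)
      where
      image≐ : ∀ {ℓ′} (E : Subset A ℓ′) → E ≐ image A μ E
      image≐ E = ≐-sym (image-of-identity μ E (surjective-idempotent⇒identity μ surj idem))

theorem6p12 : ∀ {a ℓ} (A : PseudoBCK a) (μ : PseudoBCK.Carrier A → PseudoBCK.Carrier A) →
    IsStateMorphism A μ →
    (Injective _≡_ _≡_ μ ⇔ (∀ x → Ker A μ x ⇔ (x ≡ PseudoBCK.𝟏 A)))
    × (∀ (D : Subset A ℓ) → IsDS A D → IsDS A (preimage A μ D) × _⊆_ A (Ker A μ) (preimage A μ D))
    × (∀ (D : Subset A ℓ) → IsNormalDS A D → IsNormalDS A (preimage A μ D))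
    × (∀ (D : Subset A ℓ) → IsCommutativeDS A D → IsCommutativeDS A (preimage A μ D))
    × (Surjective _≡_ _≡_ μ → ∀ (D : Subset A ℓ) → IsStateDS A μ D →
    IsStateDS A μ (image A μ D) × IsStateDS A μ (image A μ (image A μ D)))
theorem6p12 A μ SM =
  injective⇔trivial-Ker A SM ,
  (λ D ds → preimage-IsDS A SM ds , Ker⊆preimage A SM ds) ,
  (λ D → preimage-IsNormalDS A SM) ,
  (λ D → preimage-IsCommutativeDS A SM) ,
  (λ surj D → surjective-image-IsStateDS A SM surj D)
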